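{- Let $j\in\mathbb{N}$ and $r\in\mathbb{N}_0$. Then \[c_j^{(r)}=\sum_{i=0}^r\binom{r}{i}c_{j+i}.\]
   Context: $\mathbb{N}=\{1,2,\dots\}$, $\mathbb{N}_0=\mathbb{N}\cup\{0\}$. For $j\in\mathbb{N}$, $c_j(n)$ is the number of ordered tuples $(m_1,\dots,m_j)$ of integers $m_i\ge2$ with $m_1\cdots m_j=n$. The associated divisor functions are $c_j^{(0)}=c_j$ and $c_j^{(r)}(n)=\sum_{m\mid n}c_j^{(r-1)}(m)$ for $r,n\in\mathbb{N}$. -}

module Defs where

open import Data.Nat using (ℕ; zero; suc; _+_; _*_; _≤?_; _≟_)
open import Data.Nat.Divisibility using (_∣?_)
open import Data.Nat.Combinatorics using (_C_)
open import Data.List using (List; map; upTo; applyUpTo)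
open import Data.Nat.ListAction using (sum)
open import Relation.Nullary.Decidable using (does)
open import Data.Bool using (if_then_else_)

range1 : ℕ → List ℕ
range1 n = applyUpTo suc n

Σ1 : ℕ → (ℕ → ℕ) → ℕ
Σ1 n f = sum (map f (range1 n))

Σ0 : ℕ → (ℕ → ℕ) → ℕ
Σ0 r f = sum (map f (upTo (suc r)))

-- cc j n = c_{j+1}(n): number of ordered (j+1)-tuples (m_1,…,m_{j+1})
-- of integers m_i ≥ 2 with product n.  Defined by splitting off m_1:
-- c_1(n) = [n ≥ 2],  c_{j+2}(n) = Σ_{m_1 ≥ 2, b ≥ 1, m_1 * b = n} c_{j+1}(b).
cc : ℕ → ℕ → ℕ
cc zero n = if does (2 ≤? n) then 1 else 0
cc (suc j) n =
  Σ1 n λ a → Σ1 n λ b →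
    if does (2 ≤? a) then (if does (a * b ≟ n) then cc j b else 0) else 0

-- c j n  for j ∈ ℕ (j ≥ 1); c 0 is never used in the statement.
c : ℕ → ℕ → ℕ
c zero n = 0
c (suc j) n = cc j n

cr : ℕ → ℕ → ℕ → ℕ
cr j zero n = c j n
cr j (suc r) n = Σ1 n λ m → if does (m ∣? n) then cr j r m else 0

-- Splitting off the first factor m₁ = q ≥ 2 gives c_{j+1}(N) = Σ_{q b = N, q ≥ 2} c_j(b), where
-- each proper divisor b of N occurs exactly once, with q = N / b.  Hence
-- Σ_{b ∣ N} c_j(b) = c_j(N) + c_{j+1}(N):
-- taking divisor sums acts on the sequence (c_j)_j as the operator 1 + E, with E the shift
-- j ↦ j + 1, and r divisor sums act as (1 + E)^r = Σ_i (r choose i) E^i by Pascal's rule.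
module Submission where

open import Defs
open import Data.Bool using (true; false; if_then_else_)
open import Data.List using ([]; _∷_; map; applyUpTo; upTo; _∷ʳ_)
open import Data.List.Membership.Propositional using (_∈_)
open import Data.List.Membership.Propositional.Properties using (∈-applyUpTo⁺)
open import Data.List.Properties using (map-++; map-cong; map-cong-local; applyUpTo-∷ʳ; map-applyUpTo; map-upTo)
open import Data.List.Relation.Unary.All as All using (All; []; _∷_)
open import Data.List.Relation.Unary.AllPairs using (_∷_)
open import Data.List.Relation.Unary.Any using (here; there)
open import Data.List.Relation.Unary.Unique.Propositional using (Unique)
import Data.List.Relation.Unary.All.Properties as All
import Data.List.Relation.Unary.Unique.Propositional.Properties as Unique
open import Data.Nat using (ℕ; zero; suc; _+_; _*_; _≤_; _<_; z≤n; s≤s; z<s; s<s; _≤?_; _≟_; NonZero)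
open import Data.Nat.Combinatorics using (_C_; nCk+nC[k+1]≡[n+1]C[k+1]; k>n⇒nCk≡0)
open import Data.Nat.Divisibility using (_∣?_; divides; ∣-refl)
open import Data.Nat.ListAction using (sum)
open import Data.Nat.ListAction.Properties using (sum-++)
open import Data.Nat.Properties
open import Algebra.Properties.CommutativeSemigroup +-commutativeSemigroup
  using (interchange; x∙yz≈xz∙y)
open import Function using (_∘_)
open import Relation.Binary.PropositionalEquality
open import Relation.Nullary using (Dec; yes; no; contradiction)
open import Relation.Nullary.Decidable using (does; dec-true; dec-false)

module _ {A : Set} where

  sum-map-cong : ∀ {f g : A → ℕ} → (∀ x → f x ≡ g x) → ∀ xs → sum (map f xs) ≡ sum (map g xs)
  sum-map-cong f≗g xs = cong sum (map-cong f≗g xs)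

  sum-map-+ : ∀ (f g : A → ℕ) xs → sum (map (λ x → f x + g x) xs) ≡ sum (map f xs) + sum (map g xs)
  sum-map-+ f g []       = refl
  sum-map-+ f g (x ∷ xs) = trans (cong (f x + g x +_) (sum-map-+ f g xs))
                                 (interchange (f x) (g x) (sum (map f xs)) (sum (map g xs)))

  sum-map-*ˡ : ∀ k (f : A → ℕ) xs → sum (map (λ x → k * f x) xs) ≡ k * sum (map f xs)
  sum-map-*ˡ k f []       = sym (*-zeroʳ k)
  sum-map-*ˡ k f (x ∷ xs) = trans (cong (k * f x +_) (sum-map-*ˡ k f xs))
                                  (sym (*-distribˡ-+ k (f x) (sum (map f xs))))

  sum-map-zero : ∀ {f : A → ℕ} {xs} → All (λ x → f x ≡ 0) xs → sum (map f xs) ≡ 0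
  sum-map-zero []             = refl
  sum-map-zero (fx≡0 ∷ fxs≡0) = cong₂ _+_ fx≡0 (sum-map-zero fxs≡0)

  sum-map-∷ʳ : ∀ (f : A → ℕ) xs x → sum (map f (xs ∷ʳ x)) ≡ sum (map f xs) + f x
  sum-map-∷ʳ f xs x = trans (cong sum (map-++ f xs (x ∷ [])))
                            (trans (sum-++ (map f xs) (f x ∷ [])) (cong (sum (map f xs) +_) (+-identityʳ (f x))))

  sum-map-unique-point : ∀ (f : A → ℕ) {xs k} → Unique xs → k ∈ xs →
                         (∀ x → x ≢ k → f x ≡ 0) → sum (map f xs) ≡ f k
  sum-map-unique-point f (k∉xs ∷ _) (here refl) vanish =
    trans (cong (f _ +_) (sum-map-zero (All.map (λ k≢x → vanish _ (k≢x ∘ sym)) k∉xs))) (+-identityʳ _)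
  sum-map-unique-point f (x∉xs ∷ uniq) (there k∈xs) vanish =
    cong₂ _+_ (vanish _ (All.lookup x∉xs k∈xs)) (sum-map-unique-point f uniq k∈xs vanish)

  sum-map-applyUpTo-suc : ∀ (f : A → ℕ) (g : ℕ → A) n →
                            sum (map f (applyUpTo g (suc n))) ≡ sum (map f (applyUpTo g n)) + f (g n)
  sum-map-applyUpTo-suc f g n =
    trans (cong (sum ∘ map f) (sym (applyUpTo-∷ʳ g n))) (sum-map-∷ʳ f (applyUpTo g n) (g n))

  if-sum-map-*ˡ : ∀ b (w h : A → ℕ) xs →
      (if b then sum (map (λ i → w i * h i) xs) else 0) ≡ sum (map (λ i → w i * (if b then h i else 0)) xs)
  if-sum-map-*ˡ true  w h xs = refl
  if-sum-map-*ˡ false w h xs = sym (sum-map-zero (All.universal (λ i → *-zeroʳ (w i)) xs))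

module _ {A B : Set} where

  sum-map-swap : ∀ (F : A → B → ℕ) xs ys →
                 sum (map (λ x → sum (map (F x) ys)) xs) ≡ sum (map (λ y → sum (map (λ x → F x y) xs)) ys)
  sum-map-swap F []       ys = sym (sum-map-zero (All.universal (λ _ → refl) ys))
  sum-map-swap F (x ∷ xs) ys = trans (cong (sum (map (F x) ys) +_) (sum-map-swap F xs ys))
                                     (sym (sum-map-+ (F x) (λ y → sum (map (λ x → F x y) xs)) ys))

range1-unique : ∀ N → Unique (range1 N)
range1-unique N = Unique.applyUpTo⁺₁ suc N (λ i<j _ → <⇒≢ (s<s i<j))

∈-range1 : ∀ {m N} → 0 < m → m ≤ N → m ∈ range1 N
∈-range1 {suc m} _ m<N = ∈-applyUpTo⁺ suc m<N

Σ1-cong-< : ∀ N {f g : ℕ → ℕ} → (∀ {i} → i < N → f (suc i) ≡ g (suc i)) → Σ1 N f ≡ Σ1 N g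
Σ1-cong-< N f≡g = cong sum (map-cong-local (All.applyUpTo⁺₁ suc N f≡g))

-- cr j (suc r) = divisorSum (cr j r) holds definitionally.
divisorSum : (ℕ → ℕ) → ℕ → ℕ
divisorSum f N = Σ1 N (λ m → if does (m ∣? N) then f m else 0)

divisorSum-cong : ∀ {f g : ℕ → ℕ} → (∀ m → f m ≡ g m) → ∀ N → divisorSum f N ≡ divisorSum g N
divisorSum-cong f≗g N = sum-map-cong (λ m → cong (λ y → if does (m ∣? N) then y else 0) (f≗g m)) (range1 N)

divisorSum-sum-map : ∀ {A : Set} (w : A → ℕ) (g : A → ℕ → ℕ) xs N →
  divisorSum (λ m → sum (map (λ i → w i * g i m) xs)) N ≡ sum (map (λ i → w i * divisorSum (g i) N) xs)
divisorSum-sum-map w g xs N = begin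
  Σ1 N (λ m → if does (m ∣? N) then sum (map (λ i → w i * g i m) xs) else 0)
    ≡⟨ sum-map-cong (λ m → if-sum-map-*ˡ (does (m ∣? N)) w (λ i → g i m) xs) (range1 N) ⟩
  Σ1 N (λ m → sum (map (λ i → w i * (if does (m ∣? N) then g i m else 0)) xs))
    ≡⟨ sum-map-swap (λ m i → w i * (if does (m ∣? N) then g i m else 0)) (range1 N) xs ⟩
  sum (map (λ i → Σ1 N (λ m → w i * (if does (m ∣? N) then g i m else 0))) xs)
    ≡⟨ sum-map-cong (λ i → sum-map-*ˡ (w i) _ (range1 N)) xs ⟩
  sum (map (λ i → w i * divisorSum (g i) N) xs) ∎
  where open ≡-Reasoning

-- cc (suc j) N unfolds to  Σ1 N (λ a → Σ1 N (λ b → cofactorTerm N b (cc j b) a)).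
cofactorTerm : ℕ → ℕ → ℕ → ℕ → ℕ
cofactorTerm N b x a = if does (2 ≤? a) then (if does (a * b ≟ N) then x else 0) else 0

cofactorTerm-≡ : ∀ {N b a} x → 2 ≤ a → a * b ≡ N → cofactorTerm N b x a ≡ x
cofactorTerm-≡ {N} {b} {a} x 2≤a ab≡N rewrite dec-true (2 ≤? a) 2≤a | dec-true (a * b ≟ N) ab≡N = refl

cofactorTerm-≡0 : ∀ {N b} x a → (2 ≤ a → a * b ≢ N) → cofactorTerm N b x a ≡ 0
cofactorTerm-≡0 x zero       _ = refl
cofactorTerm-≡0 x (suc zero) _ = refl
cofactorTerm-≡0 {N} {b} x a@(suc (suc _)) ab≢N
  rewrite dec-false (a * b ≟ N) (ab≢N (s≤s (s≤s z≤n))) = refl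

cofactor≥2 : ∀ {N b} q → b < N → N ≡ q * b → 2 ≤ q
cofactor≥2 zero          ()  refl
cofactor≥2 (suc (suc q)) _   _    = s≤s (s≤s z≤n)
cofactor≥2 (suc zero)    b<N refl = contradiction b<N (<-irrefl (sym (+-identityʳ _)))

Σ1-cofactorTerm-< : ∀ {N b} x .{{_ : NonZero b}} → b < N →
                         Σ1 N (cofactorTerm N b x) ≡ (if does (b ∣? N) then x else 0)
Σ1-cofactorTerm-< {N} {b} x b<N with b ∣? N
... | no  b∤N =
  sum-map-zero (All.universal (λ a → cofactorTerm-≡0 x a (λ _ ab≡N → b∤N (divides a (sym ab≡N)))) (range1 N))
... | yes (divides q N≡qb) = begin
  Σ1 N (cofactorTerm N b x) ≡⟨ sum-map-unique-point (cofactorTerm N b x) (range1-unique N) q∈range vanish ⟩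
  cofactorTerm N b x q      ≡⟨ cofactorTerm-≡ x 2≤q (sym N≡qb) ⟩
  x                         ∎
  where
  open ≡-Reasoning
  2≤q : 2 ≤ q
  2≤q = cofactor≥2 q b<N N≡qb
  q∈range : q ∈ range1 N
  q∈range = ∈-range1 (<-trans z<s 2≤q) (subst (q ≤_) (sym N≡qb) (m≤m*n q b))
  vanish : ∀ a → a ≢ q → cofactorTerm N b x a ≡ 0
  vanish a a≢q = cofactorTerm-≡0 x a (λ _ ab≡N → a≢q (*-cancelʳ-≡ a q b (trans ab≡N N≡qb)))

cofactorTerm-self : ∀ {N} x .{{_ : NonZero N}} a → cofactorTerm N N x a ≡ 0
cofactorTerm-self {N} x a =
  cofactorTerm-≡0 x a (λ 2≤a aN≡N → <⇒≢ (m<m*n N a 2≤a) (sym (trans (*-comm N a) aN≡N)))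

divisorSum-cc : ∀ j N → divisorSum (cc j) N ≡ cc j N + cc (suc j) N
divisorSum-cc zero    zero    = refl
divisorSum-cc (suc j) zero    = refl
divisorSum-cc j       (suc n) = begin
  divisorSum (cc j) N
    ≡⟨ sum-map-applyUpTo-suc _ suc n ⟩
  properDivisorSum + (if does (N ∣? N) then cc j N else 0)
    ≡⟨ cong (properDivisorSum +_) (if-true (N ∣? N) ∣-refl) ⟩
  properDivisorSum + cc j N
    ≡⟨ +-comm properDivisorSum (cc j N) ⟩
  cc j N + properDivisorSum
    ≡⟨ cong (cc j N +_) cc-suc ⟨
  cc j N + cc (suc j) N ∎
  where
  open ≡-Reasoning
  N : ℕ
  N = suc n
  properDivisorSum : ℕ
  properDivisorSum = Σ1 n (λ b → if does (b ∣? N) then cc j b else 0)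
  if-true : ∀ {P : Set} (d : Dec P) {x y : ℕ} → P → (if does d then x else y) ≡ x
  if-true d p rewrite dec-true d p = refl
  cc-suc : cc (suc j) N ≡ properDivisorSum
  cc-suc = begin
    Σ1 N (λ a → Σ1 N (λ b → cofactorTerm N b (cc j b) a))
      ≡⟨ sum-map-swap (λ a b → cofactorTerm N b (cc j b) a) (range1 N) (range1 N) ⟩
    Σ1 N (λ b → Σ1 N (cofactorTerm N b (cc j b)))
      ≡⟨ sum-map-applyUpTo-suc _ suc n ⟩
    Σ1 n (λ b → Σ1 N (cofactorTerm N b (cc j b))) + Σ1 N (cofactorTerm N N (cc j N))
      ≡⟨ cong₂ _+_ (Σ1-cong-< n (λ i<n → Σ1-cofactorTerm-< _ (s<s i<n)))
                   (sum-map-zero (All.universal (cofactorTerm-self (cc j N)) (range1 N))) ⟩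
    properDivisorSum + 0
      ≡⟨ +-identityʳ properDivisorSum ⟩
    properDivisorSum ∎

binomialSum : ℕ → (ℕ → ℕ) → ℕ
binomialSum r a = Σ0 r (λ i → (r C i) * a i)

Σ0-shift : ∀ r (f : ℕ → ℕ) → Σ0 (suc r) f ≡ f 0 + Σ0 r (f ∘ suc)
Σ0-shift r f =
  cong (f 0 +_) (cong sum (trans (map-applyUpTo suc f (suc r)) (sym (map-upTo (f ∘ suc) (suc r)))))

Σ0-binomialSum : ∀ r a → Σ0 (suc r) (λ i → (r C i) * a i) ≡ binomialSum r a
Σ0-binomialSum r a = begin
  Σ0 (suc r) (λ i → (r C i) * a i)
    ≡⟨ sum-map-applyUpTo-suc (λ i → (r C i) * a i) (λ i → i) (suc r) ⟩
  binomialSum r a + (r C suc r) * a (suc r)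
    ≡⟨ cong (λ k → binomialSum r a + k * a (suc r)) (k>n⇒nCk≡0 (n<1+n r)) ⟩
  binomialSum r a + 0
    ≡⟨ +-identityʳ _ ⟩
  binomialSum r a ∎
  where open ≡-Reasoning

binomialSum-suc : ∀ r a → binomialSum (suc r) a ≡ binomialSum r a + binomialSum r (a ∘ suc)
binomialSum-suc r a = begin
  binomialSum (suc r) a
    ≡⟨ Σ0-shift r (λ i → (suc r C i) * a i) ⟩
  a₀ + Σ0 r (λ i → (suc r C suc i) * a (suc i))
    ≡⟨ cong (a₀ +_) pascal ⟩
  a₀ + (binomialSum r (a ∘ suc) + tail)
    ≡⟨ x∙yz≈xz∙y a₀ _ tail ⟩
  a₀ + tail + binomialSum r (a ∘ suc)
    ≡⟨ cong (_+ binomialSum r (a ∘ suc)) (Σ0-shift r (λ i → (r C i) * a i)) ⟨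
  Σ0 (suc r) (λ i → (r C i) * a i) + binomialSum r (a ∘ suc)
    ≡⟨ cong (_+ binomialSum r (a ∘ suc)) (Σ0-binomialSum r a) ⟩
  binomialSum r a + binomialSum r (a ∘ suc) ∎
  where
  open ≡-Reasoning
  -- Both suc r C 0 and r C 0 compute to 1, so a₀ serves as the first term on either side.
  a₀ : ℕ
  a₀ = (r C 0) * a 0
  tail : ℕ
  tail = Σ0 r (λ i → (r C suc i) * a (suc i))
  pascal : Σ0 r (λ i → (suc r C suc i) * a (suc i)) ≡ binomialSum r (a ∘ suc) + tail
  pascal = trans (sum-map-cong (λ i → trans (cong (_* a (suc i)) (sym (nCk+nC[k+1]≡[n+1]C[k+1] r i)))
                                            (*-distribʳ-+ (a (suc i)) (r C i) (r C suc i))) (upTo (suc r)))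
                 (sum-map-+ (λ i → (r C i) * a (suc i)) (λ i → (r C suc i) * a (suc i)) (upTo (suc r)))

binomialSum-+ : ∀ r (f g : ℕ → ℕ) → binomialSum r (λ i → f i + g i) ≡ binomialSum r f + binomialSum r g
binomialSum-+ r f g = trans (sum-map-cong (λ i → *-distribˡ-+ (r C i) (f i) (g i)) (upTo (suc r)))
                            (sum-map-+ (λ i → (r C i) * f i) (λ i → (r C i) * g i) (upTo (suc r)))

cr-binomialSum : ∀ j r N → cr (suc j) r N ≡ binomialSum r (λ i → c (suc j + i) N)
cr-binomialSum j zero    N =
  sym (trans (+-identityʳ _) (trans (*-identityˡ _) (cong (λ k → c k N) (+-identityʳ (suc j)))))
cr-binomialSum j (suc r) N = begin
  divisorSum (cr (suc j) r) N
    ≡⟨ divisorSum-cong (λ m → cr-binomialSum j r m) N ⟩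
  divisorSum (λ m → binomialSum r (λ i → c (suc j + i) m)) N
    ≡⟨ divisorSum-sum-map (r C_) (λ i → c (suc j + i)) (upTo (suc r)) N ⟩
  binomialSum r (λ i → divisorSum (c (suc j + i)) N)
    ≡⟨ sum-map-cong (λ i → cong ((r C i) *_) (divisorSum-c i)) (upTo (suc r)) ⟩
  binomialSum r (λ i → a i + a (suc i))
    ≡⟨ binomialSum-+ r a (a ∘ suc) ⟩
  binomialSum r a + binomialSum r (a ∘ suc)
    ≡⟨ binomialSum-suc r a ⟨
  binomialSum (suc r) a ∎
  where
  open ≡-Reasoning
  a : ℕ → ℕ
  a i = c (suc j + i) N
  divisorSum-c : ∀ i → divisorSum (c (suc j + i)) N ≡ a i + a (suc i)
  divisorSum-c i = trans (divisorSum-cc (j + i) N) (cong (λ k → a i + cc k N) (sym (+-suc j i)))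

lemma17 : (j r n : ℕ) → cr (suc j) r (suc n) ≡ Σ0 r (λ i → (r C i) * c (suc j + i) (suc n))
lemma17 j r n = cr-binomialSum j r (suc n)
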